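{- Any finitely generated odd FL$_e$-chain has only finitely many positive idempotent elements.
   Context: An FL$_e$-algebra is a structure $(X,\wedge,\vee,*,\to,t,f)$ such that $(X,\wedge,\vee)$ is a lattice, $(X,\le,*,t)$ is a commutative monoid residuated with residual $\to$ (i.e. $x*y\le z$ iff $y\le x\to z$), and $f$ is an arbitrary constant; put $x'=x\to f$. It is involutive if $x''=x$ for all $x$, and odd if it is involutive and $t=f$. An FL$_e$-chain is an FL$_e$-algebra whose lattice order is total. Finitely generated refers to generation as an FL$_e$-algebra (operations $\wedge,\vee,*,\to$ and constants $t,f$). An element $x$ is a positive idempotent if $x\ge t$ and $x*x=x$. -}

module Defs where

open import Level using (Level; suc; _⊔_)
open import Data.Nat using (ℕ)
open import Data.Fin using (Fin)
open import Data.List using (List)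
open import Data.List.Membership.Propositional using (_∈_)
open import Data.Product using (Σ; ∃; _×_; _,_)
open import Data.Sum using (_⊎_)
open import Function.Bundles using (_⇔_)
open import Relation.Binary.PropositionalEquality using (_≡_)
open import Algebra.Structures using (IsCommutativeMonoid)
open import Algebra.Lattice.Structures using (IsLattice)

record FLeAlgebra (a : Level) : Set (suc a) where
  infixr 6 _∨_
  infixr 7 _∧_
  infixr 8 _*_
  infixr 5 _⇒_
  infix 4 _≤_
  field
    Carrier : Set a
    _∧_ _∨_ _*_ _⇒_ : Carrier → Carrier → Carrier
    t f : Carrier
    isLattice : IsLattice _≡_ _∨_ _∧_
    isCommutativeMonoid : IsCommutativeMonoid _≡_ _*_ t

  _≤_ : Carrier → Carrier → Set a
  x ≤ y = x ∧ y ≡ x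

  field
    residuated : ∀ x y z → (x * y ≤ z) ⇔ (y ≤ x ⇒ z)

  _′ : Carrier → Carrier
  x ′ = x ⇒ f

module _ {a : Level} (A : FLeAlgebra a) where
  open FLeAlgebra A

  IsInvolutive : Set a
  IsInvolutive = ∀ x → (x ′) ′ ≡ x

  IsOdd : Set a
  IsOdd = IsInvolutive × (t ≡ f)

  IsChain : Set a
  IsChain = ∀ x y → (x ≤ y) ⊎ (y ≤ x)

  IsPositiveIdempotent : Carrier → Set a
  IsPositiveIdempotent x = (t ≤ x) × (x * x ≡ x)

data Term (n : ℕ) : Set where
  var : Fin n → Term n
  _∧ₜ_ _∨ₜ_ _*ₜ_ _⇒ₜ_ : Term n → Term n → Term n
  tₜ fₜ : Term n

module _ {a : Level} (A : FLeAlgebra a) where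
  open FLeAlgebra A

  eval : {n : ℕ} → (Fin n → Carrier) → Term n → Carrier
  eval g (var i) = g i
  eval g (s ∧ₜ u) = eval g s ∧ eval g u
  eval g (s ∨ₜ u) = eval g s ∨ eval g u
  eval g (s *ₜ u) = eval g s * eval g u
  eval g (s ⇒ₜ u) = eval g s ⇒ eval g u
  eval g tₜ = t
  eval g fₜ = f

  IsFinitelyGenerated : Set a
  IsFinitelyGenerated =
    Σ ℕ λ n → Σ (Fin n → Carrier) λ g → ∀ x → Σ (Term n) λ s → eval g s ≡ x

  FinitelyMany : (Carrier → Set a) → Set a
  FinitelyMany P = Σ (List Carrier) λ L → ∀ x → P x → x ∈ L

-- The proof goes through the "stabiliser" map  τ x = x ⇒ x.
--  * In every FLe-algebra, τ x is the largest u with x * u ≤ x; it is a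
--    positive idempotent, and every positive idempotent w satisfies τ w = w.
--    So the positive idempotents are exactly the fixed points of τ and lie
--    in the image of τ.
--  * In an involutive algebra x ⇒ y = (x * y′)′ and τ (x′) = τ x.
--  * In an odd chain, τ (x ∘ y) ∈ {τ x, τ y} for each binary operation
--    ∘ ∈ {∧, ∨, *, ⇒}, while τ t = τ f = t.
-- By induction on terms, τ of every element generated by g₁ … gₙ lies in the
-- finite list  t, τ g₁, …, τ gₙ ; hence so does every positive idempotent.
module Submission where

open import Level using (Level)
open import Defs
open import Data.Nat using (ℕ)
open import Data.Fin using (Fin)
open import Data.List using (List; _∷_; map; allFin)
open import Data.List.Membership.Propositional using (_∈_)
open import Data.List.Membership.Propositional.Properties using (∈-map⁺; ∈-allFin)
open import Data.List.Relation.Unary.Any using (here; there)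
open import Data.Product using (_,_; proj₁; proj₂)
open import Data.Sum using (_⊎_; inj₁; inj₂)
open import Function.Bundles using (Equivalence)
open import Relation.Binary.PropositionalEquality
open import Algebra.Structures using (IsCommutativeMonoid)
open import Algebra.Lattice.Structures using (IsLattice)

module Basics {a : Level} (A : FLeAlgebra a) where
  open FLeAlgebra A
  open IsLattice isLattice using (∧-comm; ∧-assoc; absorptive)
  open IsCommutativeMonoid isCommutativeMonoid using (assoc; comm; identityˡ; identityʳ)
  open ≡-Reasoning

  ≤-refl : ∀ {x} → x ≤ x
  ≤-refl {x} = begin
    x ∧ x                 ≡⟨ cong (x ∧_) (sym (proj₁ absorptive x x)) ⟩
    x ∧ (x ∨ (x ∧ x))     ≡⟨ proj₂ absorptive x (x ∧ x) ⟩
    x                     ∎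

  ≡⇒≤ : ∀ {x y} → x ≡ y → x ≤ y
  ≡⇒≤ refl = ≤-refl

  ≤-trans : ∀ {x y z} → x ≤ y → y ≤ z → x ≤ z
  ≤-trans {x} {y} {z} x≤y y≤z = begin
    x ∧ z         ≡⟨ cong (_∧ z) (sym x≤y) ⟩
    (x ∧ y) ∧ z   ≡⟨ ∧-assoc x y z ⟩
    x ∧ (y ∧ z)   ≡⟨ cong (x ∧_) y≤z ⟩
    x ∧ y         ≡⟨ x≤y ⟩
    x             ∎

  ≤-antisym : ∀ {x y} → x ≤ y → y ≤ x → x ≡ y
  ≤-antisym {x} {y} x≤y y≤x = trans (sym x≤y) (trans (∧-comm x y) y≤x)

  residual-intro : ∀ {x y z} → x * y ≤ z → y ≤ x ⇒ z
  residual-intro {x} {y} {z} = Equivalence.to (residuated x y z)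

  residual-elim : ∀ {x y z} → y ≤ x ⇒ z → x * y ≤ z
  residual-elim {x} {y} {z} = Equivalence.from (residuated x y z)

  modus-ponens : ∀ x z → x * (x ⇒ z) ≤ z
  modus-ponens x z = residual-elim ≤-refl

  *-monoʳ : ∀ {x y} z → x ≤ y → z * x ≤ z * y
  *-monoʳ z x≤y = residual-elim (≤-trans x≤y (residual-intro ≤-refl))

  *-monoˡ : ∀ {x y} z → x ≤ y → x * z ≤ y * z
  *-monoˡ {x} {y} z x≤y = subst₂ _≤_ (comm z x) (comm z y) (*-monoʳ z x≤y)

  ≤t-*-closed : ∀ {p q} → p ≤ t → q ≤ t → p * q ≤ t
  ≤t-*-closed {p} p≤t q≤t =
    ≤-trans (*-monoʳ p q≤t) (subst (_≤ t) (sym (identityʳ p)) p≤t)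

  interchange : ∀ p q r s → (p * q) * (r * s) ≡ (p * r) * (q * s)
  interchange p q r s = begin
    (p * q) * (r * s)   ≡⟨ assoc p q (r * s) ⟩
    p * (q * (r * s))   ≡⟨ cong (p *_) (sym (assoc q r s)) ⟩
    p * ((q * r) * s)   ≡⟨ cong (λ w → p * (w * s)) (comm q r) ⟩
    p * ((r * q) * s)   ≡⟨ cong (p *_) (assoc r q s) ⟩
    p * (r * (q * s))   ≡⟨ sym (assoc p r (q * s)) ⟩
    (p * r) * (q * s)   ∎

  τ : Carrier → Carrier
  τ x = x ⇒ x

  t≤τ : ∀ x → t ≤ τ x
  t≤τ x = residual-intro (≡⇒≤ (identityʳ x))

  τ-idempotent : ∀ x → τ x * τ x ≡ τ x
  τ-idempotent x = ≤-antisym square≤ ≤square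
    where
    square≤ : τ x * τ x ≤ τ x
    square≤ = residual-intro (≤-trans (≡⇒≤ (sym (assoc x (τ x) (τ x))))
                (≤-trans (*-monoˡ (τ x) (modus-ponens x x)) (modus-ponens x x)))
    ≤square : τ x ≤ τ x * τ x
    ≤square = ≤-trans (≡⇒≤ (sym (identityˡ (τ x)))) (*-monoˡ (τ x) (t≤τ x))

  τ-fixes-positive-idempotent : ∀ w → IsPositiveIdempotent A w → τ w ≡ w
  τ-fixes-positive-idempotent w (t≤w , ww≡w) = ≤-antisym τw≤w (residual-intro (≡⇒≤ ww≡w))
    where
    τw≤w : τ w ≤ w
    τw≤w = ≤-trans (≡⇒≤ (sym (identityʳ (τ w))))
             (≤-trans (*-monoʳ (τ w) t≤w)
               (≤-trans (≡⇒≤ (comm (τ w) w)) (modus-ponens w w)))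

  τ-t : τ t ≡ t
  τ-t = ≤-antisym (subst (_≤ t) (identityˡ (τ t)) (modus-ponens t t)) (t≤τ t)

  τ-≤-τ-* : ∀ x y → τ x ≤ τ (x * y)
  τ-≤-τ-* x y = residual-intro (≤-trans (≡⇒≤ rearrange) (*-monoˡ y (modus-ponens x x)))
    where
    rearrange : (x * y) * τ x ≡ (x * τ x) * y
    rearrange = begin
      (x * y) * τ x   ≡⟨ assoc x y (τ x) ⟩
      x * (y * τ x)   ≡⟨ cong (x *_) (comm y (τ x)) ⟩
      x * (τ x * y)   ≡⟨ sym (assoc x (τ x) y) ⟩
      (x * τ x) * y   ∎

module Involutive {a : Level} (A : FLeAlgebra a) (inv : IsInvolutive A) where
  open FLeAlgebra A
  open IsCommutativeMonoid isCommutativeMonoid using (assoc; comm)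
  open Basics A
  open ≡-Reasoning

  -- Contraposition through f:  (x * y′) * z ≤ f  iff  x * z ≤ y.
  -- The reassociation below moves y′ to the front so residuation applies.
  swap : ∀ x y z → (x * (y ′)) * z ≡ (y ′) * (x * z)
  swap x y z = begin
    (x * (y ′)) * z   ≡⟨ cong (_* z) (comm x (y ′)) ⟩
    ((y ′) * x) * z   ≡⟨ assoc (y ′) x z ⟩
    (y ′) * (x * z)   ∎

  contra-intro : ∀ {x y z} → x * z ≤ y → (x * (y ′)) * z ≤ f
  contra-intro {x} {y} {z} xz≤y =
    subst (_≤ f) (sym (swap x y z)) (residual-elim (subst (x * z ≤_) (sym (inv y)) xz≤y))

  contra-elim : ∀ {x y z} → (x * (y ′)) * z ≤ f → x * z ≤ y
  contra-elim {x} {y} {z} h = subst (x * z ≤_) (inv y) (residual-intro (subst (_≤ f) (swap x y z) h))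

  ⇒-via-* : ∀ x y → x ⇒ y ≡ (x * (y ′)) ′
  ⇒-via-* x y = ≤-antisym
    (residual-intro (contra-intro (modus-ponens x y)))
    (residual-intro (contra-elim (modus-ponens (x * (y ′)) f)))

  τ-′ : ∀ x → τ (x ′) ≡ τ x
  τ-′ x = begin
    (x ′) ⇒ (x ′)          ≡⟨ ⇒-via-* (x ′) (x ′) ⟩
    ((x ′) * ((x ′) ′)) ′  ≡⟨ cong (λ w → ((x ′) * w) ′) (inv x) ⟩
    ((x ′) * x) ′          ≡⟨ cong _′ (comm (x ′) x) ⟩
    (x * (x ′)) ′          ≡⟨ sym (⇒-via-* x x) ⟩
    x ⇒ x                  ∎

module Odd {a : Level} (A : FLeAlgebra a) (odd : IsOdd A) where
  open FLeAlgebra A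
  open IsCommutativeMonoid isCommutativeMonoid using (assoc; comm)
  open Basics A
  open Involutive A (proj₁ odd)
  open ≡-Reasoning

  t≡f : t ≡ f
  t≡f = proj₂ odd

  x*x′≤t : ∀ x → x * (x ′) ≤ t
  x*x′≤t x = subst (x * (x ′) ≤_) (sym t≡f) (modus-ponens x f)

  ′-* : ∀ x y → (x ′) * (y ′) ≤ (x * y) ′
  ′-* x y = residual-intro (subst ((x * y) * ((x ′) * (y ′)) ≤_) t≡f
    (subst (_≤ t) (sym (interchange x y (x ′) (y ′)))
      (≤t-*-closed (x*x′≤t x) (x*x′≤t y))))

  -- Call u * (x * x′) the defect of u at x; if it is at most t = f,
  -- then x * u ≤ x by contraposition, i.e. u ≤ τ x.
  ≤τ-via-unit : ∀ {u x} → u * (x * (x ′)) ≤ t → u ≤ τ x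
  ≤τ-via-unit {u} {x} h = residual-intro (contra-elim
    (subst (_≤ f) (comm u (x * (x ′))) (subst (u * (x * (x ′)) ≤_) t≡f h)))

  -- For u = τ (x * y), the defects of u at x and at y multiply to at most t:
  -- their product is u * ((x * y) * (x′ * y′)) ≤ u * ((x * y) * (x * y)′) ≤ t.
  τ-defects-bounded : ∀ x y → let u = τ (x * y) in
    (u * (x * (x ′))) * (u * (y * (y ′))) ≤ t
  τ-defects-bounded x y = ≤-trans (≡⇒≤ regroup)
    (≤-trans (*-monoʳ u (*-monoʳ z (′-* x y)))
      (≤-trans (≡⇒≤ (sym (assoc u z (z ′))))
        (≤-trans (*-monoˡ (z ′) (subst (_≤ z) (comm z u) (modus-ponens z z)))
          (x*x′≤t z))))
    where
    z = x * y
    u = τ z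
    regroup : (u * (x * (x ′))) * (u * (y * (y ′))) ≡ u * (z * ((x ′) * (y ′)))
    regroup = begin
      (u * (x * (x ′))) * (u * (y * (y ′)))   ≡⟨ interchange u (x * (x ′)) u (y * (y ′)) ⟩
      (u * u) * ((x * (x ′)) * (y * (y ′)))   ≡⟨ cong₂ _*_ (τ-idempotent z) (interchange x (x ′) y (y ′)) ⟩
      u * (z * ((x ′) * (y ′)))               ∎

module OddChain {a : Level} (A : FLeAlgebra a) (odd : IsOdd A) (chain : IsChain A) where
  open FLeAlgebra A
  open IsLattice isLattice using (∨-comm; ∧-comm; absorptive)
  open IsCommutativeMonoid isCommutativeMonoid using (comm; identityʳ)
  open Basics A
  open Involutive A (proj₁ odd)
  open Odd A odd

  ∧-selective : ∀ x y → (x ∧ y ≡ x) ⊎ (x ∧ y ≡ y)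
  ∧-selective x y with chain x y
  ... | inj₁ x≤y = inj₁ x≤y
  ... | inj₂ y≤x = inj₂ (trans (∧-comm x y) y≤x)

  ∨-selective : ∀ x y → (x ∨ y ≡ x) ⊎ (x ∨ y ≡ y)
  ∨-selective x y with chain x y
  ... | inj₁ x≤y = inj₂ (trans (∨-comm x y)
                   (subst (λ w → y ∨ w ≡ y) (trans (∧-comm y x) x≤y) (proj₁ absorptive y x)))
  ... | inj₂ y≤x = inj₁ (subst (λ w → x ∨ w ≡ x) (trans (∧-comm x y) y≤x) (proj₁ absorptive x y))

  -- If the defect of τ (x * y) at y is ≤ t, then τ (x * y) = τ y; otherwise it
  -- is ≥ t and, by τ-defects-bounded, the defect at x is ≤ t, so τ (x * y) = τ x.
  τ-* : ∀ x y → (τ (x * y) ≡ τ x) ⊎ (τ (x * y) ≡ τ y)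
  τ-* x y with chain (τ (x * y) * (y * (y ′))) t
  ... | inj₁ defect-y≤t = inj₂ (≤-antisym (≤τ-via-unit defect-y≤t)
                            (subst (τ y ≤_) (cong τ (comm y x)) (τ-≤-τ-* y x)))
  ... | inj₂ t≤defect-y = inj₁ (≤-antisym (≤τ-via-unit defect-x≤t) (τ-≤-τ-* x y))
    where
    defect-x = τ (x * y) * (x * (x ′))
    defect-x≤t : defect-x ≤ t
    defect-x≤t = ≤-trans (≡⇒≤ (sym (identityʳ defect-x)))
                   (≤-trans (*-monoʳ defect-x t≤defect-y) (τ-defects-bounded x y))

  -- By  x ⇒ y = (x * y′)′  the implication case reduces to the product case.
  τ-⇒≡τ-* : ∀ x y → τ (x ⇒ y) ≡ τ (x * (y ′))
  τ-⇒≡τ-* x y = trans (cong τ (⇒-via-* x y)) (τ-′ (x * (y ′)))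

  τ-⇒ : ∀ x y → (τ (x ⇒ y) ≡ τ x) ⊎ (τ (x ⇒ y) ≡ τ y)
  τ-⇒ x y with τ-* x (y ′)
  ... | inj₁ e = inj₁ (trans (τ-⇒≡τ-* x y) e)
  ... | inj₂ e = inj₂ (trans (τ-⇒≡τ-* x y) (trans e (τ-′ y)))

  module Generated {n : ℕ} (g : Fin n → Carrier) where
    τ-generators : List Carrier
    τ-generators = t ∷ map (λ i → τ (g i)) (allFin n)

    one-of : ∀ {p q r} → (r ≡ p) ⊎ (r ≡ q) → p ∈ τ-generators → q ∈ τ-generators
      → r ∈ τ-generators
    one-of (inj₁ r≡p) p∈ q∈ = subst (_∈ τ-generators) (sym r≡p) p∈
    one-of (inj₂ r≡q) p∈ q∈ = subst (_∈ τ-generators) (sym r≡q) q∈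

    cong-τ : ∀ {p q r} → (r ≡ p) ⊎ (r ≡ q) → (τ r ≡ τ p) ⊎ (τ r ≡ τ q)
    cong-τ (inj₁ r≡p) = inj₁ (cong τ r≡p)
    cong-τ (inj₂ r≡q) = inj₂ (cong τ r≡q)

    τ-term : ∀ s → τ (eval A g s) ∈ τ-generators
    τ-term (var i)  = there (∈-map⁺ (λ i → τ (g i)) (∈-allFin i))
    τ-term (s ∧ₜ u) = one-of (cong-τ (∧-selective (eval A g s) (eval A g u))) (τ-term s) (τ-term u)
    τ-term (s ∨ₜ u) = one-of (cong-τ (∨-selective (eval A g s) (eval A g u))) (τ-term s) (τ-term u)
    τ-term (s *ₜ u) = one-of (τ-* (eval A g s) (eval A g u)) (τ-term s) (τ-term u)
    τ-term (s ⇒ₜ u) = one-of (τ-⇒ (eval A g s) (eval A g u)) (τ-term s) (τ-term u)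
    τ-term tₜ       = subst (_∈ τ-generators) (sym τ-t) (here refl)
    τ-term fₜ       = subst (_∈ τ-generators) (trans (sym τ-t) (cong τ t≡f)) (here refl)

proposition1 : {a : Level} (A : FLeAlgebra a) → IsOdd A → IsChain A → IsFinitelyGenerated A
    → FinitelyMany A (IsPositiveIdempotent A)
proposition1 A odd chain (n , g , generates) = τ-generators , listed
  where
  open Basics A using (τ; τ-fixes-positive-idempotent)
  open OddChain.Generated A odd chain g using (τ-generators; τ-term)

  listed : ∀ w → IsPositiveIdempotent A w → w ∈ τ-generators
  listed w w-posidem with generates w
  ... | s , s≡w = subst (_∈ τ-generators)
                    (trans (cong τ s≡w) (τ-fixes-positive-idempotent w w-posidem))
                    (τ-term s)
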